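{- For all closed terms $t_0,t_1$ of $\lambda_S$, if $t_0 \cong t_1$ then $t_0 \cong_p t_1$.
   Context: The calculus $\lambda_S$: terms $t ::= v \mid t\,t \mid \mathcal{S}k.t \mid \langle t\rangle$, values $v ::= x \mid \lambda x.t$. Pure contexts $E ::= \square \mid v\,E \mid E\,t$; evaluation contexts $F ::= \square \mid v\,F \mid F\,t \mid \langle F\rangle$; contexts $C ::= \square \mid \lambda x.C \mid t\,C \mid C\,t \mid \mathcal{S}k.C \mid \langle C\rangle$. Reduction: $F[(\lambda x.t)\,v] \to F[t\{v/x\}]$; $F[\langle E[\mathcal{S}k.t]\rangle] \to F[\langle t\{\lambda x.\langle E[x]\rangle/k\}\rangle]$ ($x\notin\mathrm{fv}(E)$); $F[\langle v\rangle]\to F[v]$. Stuck term: non-value that does not reduce; control-stuck term: $E[\mathcal{S}k.t]$; normal form: value or stuck term; $t\Downarrow t'$: $t\to^*t'$ with $t'$ normal form. Relaxed contextual equivalence on closed terms: $t_0\cong t_1$ iff for every closed context $C$, $C[t_0]$ evaluates to a value iff $C[t_1]$ does, and $C[t_0]$ evaluates to a control-stuck term iff $C[t_1]$ does. Contextual equivalence for the original semantics on closed terms: $t_0\cong_p t_1$ iff for every closed context $C$, $\langle C[t_0]\rangle\Downarrow v_0$ for some value $v_0$ iff $\langle C[t_1]\rangle\Downarrow v_1$ for some value $v_1$. -}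

module Defs where

open import Data.Nat using (ℕ; zero; suc)
open import Data.Fin using (Fin; zero; suc)
open import Data.Product using (Σ; ∃; _×_; _,_)
open import Data.Sum using (_⊎_)
open import Data.Empty using (⊥)
open import Relation.Nullary using (¬_)
open import Relation.Binary.Construct.Closure.ReflexiveTransitive using (Star)
open import Function.Bundles using (_⇔_)
open import Relation.Binary.PropositionalEquality using (_≡_)

-- Terms of λ_S, well-scoped de Bruijn syntax: Term n has n free variables.
--   lam t   = λx.t      (x is variable 0 in t)
--   shift t = S k.t     (k is variable 0 in t)
--   reset t = ⟨t⟩
data Term (n : ℕ) : Set where
  var   : Fin n → Term n
  lam   : Term (suc n) → Term n
  app   : Term n → Term n → Term n
  shift : Term (suc n) → Term n
  reset : Term n → Term n

data Value {n : ℕ} : Term n → Set where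
  var : (i : Fin n) → Value (var i)
  lam : (t : Term (suc n)) → Value (lam t)

Ren : ℕ → ℕ → Set
Ren n m = Fin n → Fin m

extR : ∀ {n m} → Ren n m → Ren (suc n) (suc m)
extR ρ zero    = zero
extR ρ (suc i) = suc (ρ i)

rename : ∀ {n m} → Ren n m → Term n → Term m
rename ρ (var i)   = var (ρ i)
rename ρ (lam t)   = lam (rename (extR ρ) t)
rename ρ (app t u) = app (rename ρ t) (rename ρ u)
rename ρ (shift t) = shift (rename (extR ρ) t)
rename ρ (reset t) = reset (rename ρ t)

weaken : ∀ {n} → Term n → Term (suc n)
weaken = rename suc

Sub : ℕ → ℕ → Set
Sub n m = Fin n → Term m

extS : ∀ {n m} → Sub n m → Sub (suc n) (suc m)
extS σ zero    = var zero
extS σ (suc i) = weaken (σ i)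

subst : ∀ {n m} → Sub n m → Term n → Term m
subst σ (var i)   = σ i
subst σ (lam t)   = lam (subst (extS σ) t)
subst σ (app t u) = app (subst σ t) (subst σ u)
subst σ (shift t) = shift (subst (extS σ) t)
subst σ (reset t) = reset (subst σ t)

sub0 : ∀ {n} → Term n → Sub (suc n) n
sub0 u zero    = u
sub0 u (suc i) = var i

_[_] : ∀ {n} → Term (suc n) → Term n → Term n
t [ u ] = subst (sub0 u) t

data PCtx (n : ℕ) : Set where
  hole : PCtx n
  appR : (v : Term n) → Value v → PCtx n → PCtx n
  appL : PCtx n → Term n → PCtx n

plugE : ∀ {n} → PCtx n → Term n → Term n
plugE hole         t = t
plugE (appR v _ E) t = app v (plugE E t)
plugE (appL E u)   t = app (plugE E t) u

renameE : ∀ {n m} → Ren n m → PCtx n → PCtx m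
renameE ρ hole = hole
renameE ρ (appR (var i) (var .i) E) = appR (var (ρ i)) (var (ρ i)) (renameE ρ E)
renameE ρ (appR (lam t) (lam .t) E) = appR (lam (rename (extR ρ) t)) (lam _) (renameE ρ E)
renameE ρ (appL E u) = appL (renameE ρ E) (rename ρ u)

data ECtx (n : ℕ) : Set where
  hole  : ECtx n
  appR  : (v : Term n) → Value v → ECtx n → ECtx n
  appL  : ECtx n → Term n → ECtx n
  reset : ECtx n → ECtx n

plugF : ∀ {n} → ECtx n → Term n → Term n
plugF hole         t = t
plugF (appR v _ F) t = app v (plugF F t)
plugF (appL F u)   t = app (plugF F t) u
plugF (reset F)    t = reset (plugF F t)

-- Contexts  C ::= □ | λx.C | t C | C t | S k.C | ⟨C⟩
-- Ctx n m : the context lives in scope n, its hole in scope m.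
data Ctx (n : ℕ) : ℕ → Set where
  hole  : Ctx n n
  lam   : ∀ {m} → Ctx (suc n) m → Ctx n m
  appR  : ∀ {m} → Term n → Ctx n m → Ctx n m
  appL  : ∀ {m} → Ctx n m → Term n → Ctx n m
  shift : ∀ {m} → Ctx (suc n) m → Ctx n m
  reset : ∀ {m} → Ctx n m → Ctx n m

plugC : ∀ {n m} → Ctx n m → Term m → Term n
plugC hole      t = t
plugC (lam C)   t = lam (plugC C t)
plugC (appR u C) t = app u (plugC C t)
plugC (appL C u) t = app (plugC C t) u
plugC (shift C) t = shift (plugC C t)
plugC (reset C) t = reset (plugC C t)

-- closed terms are embedded into any scope (variables cannot be captured)
embed : ∀ {m} → Term 0 → Term m
embed {m} = rename {0} {m} (λ ())

_⟦_⟧ : ∀ {m} → Ctx 0 m → Term 0 → Term 0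
C ⟦ t ⟧ = plugC C (embed t)

data _⟶_ {n : ℕ} : Term n → Term n → Set where
  β     : ∀ (F : ECtx n) (t : Term (suc n)) (v : Term n) → Value v →
          plugF F (app (lam t) v) ⟶ plugF F (t [ v ])
  shift : ∀ (F : ECtx n) (E : PCtx n) (t : Term (suc n)) →
          plugF F (reset (plugE E (shift t)))
            ⟶ plugF F (reset (t [ lam (reset (plugE (renameE suc E) (var zero))) ]))
  reset : ∀ (F : ECtx n) (v : Term n) → Value v →
          plugF F (reset v) ⟶ plugF F v

_⟶*_ : ∀ {n} → Term n → Term n → Set
_⟶*_ = Star _⟶_

Reduces : ∀ {n} → Term n → Set
Reduces t = ∃ λ t' → t ⟶ t'

Stuck : ∀ {n} → Term n → Set
Stuck t = ¬ Value t × ¬ Reduces t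

ControlStuck : ∀ {n} → Term n → Set
ControlStuck {n} t = Σ (PCtx n) λ E → Σ (Term (suc n)) λ s → t ≡ plugE E (shift s)

NormalForm : ∀ {n} → Term n → Set
NormalForm t = Value t ⊎ Stuck t

_⇓_ : ∀ {n} → Term n → Term n → Set
t ⇓ t' = (t ⟶* t') × NormalForm t'

EvalsToValue : Term 0 → Set
EvalsToValue t = ∃ λ v → t ⇓ v × Value v

EvalsToControlStuck : Term 0 → Set
EvalsToControlStuck t = ∃ λ u → t ⇓ u × ControlStuck u

_≅_ : Term 0 → Term 0 → Set
t₀ ≅ t₁ = ∀ {m} (C : Ctx 0 m) →
  (EvalsToValue (C ⟦ t₀ ⟧) ⇔ EvalsToValue (C ⟦ t₁ ⟧)) ×
  (EvalsToControlStuck (C ⟦ t₀ ⟧) ⇔ EvalsToControlStuck (C ⟦ t₁ ⟧))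

-- contextual equivalence ≅ₚ for the original semantics (programs are ⟨C[t]⟩)
_≅ₚ_ : Term 0 → Term 0 → Set
t₀ ≅ₚ t₁ = ∀ {m} (C : Ctx 0 m) →
  EvalsToValue (reset (C ⟦ t₀ ⟧)) ⇔ EvalsToValue (reset (C ⟦ t₁ ⟧))

module Submission where

open import Defs
open import Data.Product using (proj₁)

proposition3p9 : (t₀ t₁ : Term 0) → t₀ ≅ t₁ → t₀ ≅ₚ t₁
proposition3p9 t₀ t₁ t₀≅t₁ C = proj₁ (t₀≅t₁ (reset C))
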